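{- Let $\Gamma$ be a fixed abelian group containing an element of order two. Then any algorithm solving Non-Zero Common Basis for $\Gamma$ requires, in the worst case, a number of independence oracle queries exponential in the size of the ground set.
   Context: Non-Zero Common Basis: given two matroids $M_1,M_2$ on a common ground set $E$, each accessed via an independence oracle, and a labeling $\psi\colon E\to\Gamma$, find a common basis $B$ with $\psi(B):=\sum_{e\in B}\psi(e)\ne0$, or correctly report that none exists. -}

module Defs where

open import Level using (Level; _⊔_)
open import Data.Nat using (ℕ; zero; suc; _<_; _≤_; _+_)
open import Data.Bool using (Bool; true; false)
open import Data.Fin using (Fin)
import Data.Fin as F
open import Data.Fin.Subset using (Subset; ⊥; ⁅_⁆; _∈_; _∉_; _⊆_; _∪_; ∣_∣; inside; outside)
open import Data.Vec using ([]; _∷_)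
open import Data.Maybe using (Maybe; just; nothing)
open import Data.Product using (Σ; ∃; _×_; _,_)
open import Relation.Binary.PropositionalEquality using (_≡_)
open import Relation.Nullary using (¬_)
open import Algebra.Bundles using (AbelianGroup)

record Matroid (n : ℕ) : Set where
  field
    indep      : Subset n → Bool
    indep-∅    : indep ⊥ ≡ true
    hereditary : ∀ {X Y} → X ⊆ Y → indep Y ≡ true → indep X ≡ true
    augment    : ∀ {X Y} → indep X ≡ true → indep Y ≡ true → ∣ X ∣ < ∣ Y ∣ →
                 Σ (Fin n) λ e → e ∈ Y × e ∉ X × indep (X ∪ ⁅ e ⁆) ≡ true

open Matroid public

IsBasis : ∀ {n} → Matroid n → Subset n → Set
IsBasis M B = indep M B ≡ true × (∀ e → e ∉ B → indep M (B ∪ ⁅ e ⁆) ≡ false)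

IsCommonBasis : ∀ {n} → Matroid n → Matroid n → Subset n → Set
IsCommonBasis M₁ M₂ B = IsBasis M₁ B × IsBasis M₂ B

module _ {c ℓ : Level} (Γ : AbelianGroup c ℓ) where
  open AbelianGroup Γ

  HasElementOfOrderTwo : Set (c ⊔ ℓ)
  HasElementOfOrderTwo = Σ Carrier λ g → ¬ (g ≈ ε) × (g ∙ g) ≈ ε

  sumOver : ∀ {n} → (Fin n → Carrier) → Subset n → Carrier
  sumOver ψ []              = ε
  sumOver ψ (inside  ∷ B)  = ψ F.zero ∙ sumOver (λ i → ψ (F.suc i)) B
  sumOver ψ (outside ∷ B)  = sumOver (λ i → ψ (F.suc i)) B

  IsNonZeroCommonBasis : ∀ {n} → Matroid n → Matroid n → (Fin n → Carrier) →
                         Subset n → Set ℓ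
  IsNonZeroCommonBasis M₁ M₂ ψ B =
    Lift' (IsCommonBasis M₁ M₂ B) × ¬ (sumOver ψ B ≈ ε)
    where
    Lift' : Set → Set ℓ
    Lift' A = Level.Lift ℓ A

-- Deterministic (adaptive) independence-oracle algorithms on ground set
-- Fin n, as decision trees: an internal node asks "is S independent in
-- M₁ (false) / M₂ (true)?" and branches on the answer; a leaf outputs
-- either  just B  (a claimed solution) or  nothing  ("none exists").

data QueryTree (n : ℕ) : Set where
  answer : Maybe (Subset n) → QueryTree n
  query  : (which : Bool) → (S : Subset n) → (Bool → QueryTree n) → QueryTree n

oracle : ∀ {n} → Matroid n → Matroid n → Bool → Subset n → Bool
oracle M₁ M₂ false S = indep M₁ S
oracle M₁ M₂ true  S = indep M₂ S

run : ∀ {n} → QueryTree n → Matroid n → Matroid n → Maybe (Subset n)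
run (answer o)     M₁ M₂ = o
run (query w S k)  M₁ M₂ = run (k (oracle M₁ M₂ w S)) M₁ M₂

queries : ∀ {n} → QueryTree n → Matroid n → Matroid n → ℕ
queries (answer o)     M₁ M₂ = 0
queries (query w S k)  M₁ M₂ = suc (queries (k (oracle M₁ M₂ w S)) M₁ M₂)

module _ {c ℓ : Level} (Γ : AbelianGroup c ℓ) where
  open AbelianGroup Γ

  -- Computation other than queries is unrestricted.
  Algorithm : Set c
  Algorithm = (n : ℕ) → (Fin n → Carrier) → QueryTree n

  SolvesNZCB : Algorithm → Set (c ⊔ ℓ)
  SolvesNZCB A =
    ∀ n (ψ : Fin n → Carrier) (M₁ M₂ : Matroid n) →
      (∀ B → run (A n ψ) M₁ M₂ ≡ just B → IsNonZeroCommonBasis Γ M₁ M₂ ψ B)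
      × (run (A n ψ) M₁ M₂ ≡ nothing → ∀ B → ¬ IsNonZeroCommonBasis Γ M₁ M₂ ψ B)

{-# OPTIONS --safe #-}

-- Split the ground set into m pairs, let M₁ be the partition matroid whose bases are the
-- transversals of the pairs, and label the first element of every pair by an element g of
-- order two and everything else by ε; a transversal then has weight g or ε according to the
-- parity of the number of first elements it contains. Let M₀ be the sparse paving matroid of
-- rank m whose circuit-hyperplanes are the odd transversals: two odd transversals never differ
-- by a single exchange, since such an exchange stays within one pair and flips the parity. The
-- common bases of M₁ and M₀ are exactly the even transversals, so (M₁, M₀) has no solution,
-- while relaxing one odd transversal H into a basis gives an instance whose only solution is
-- H. The relaxed oracle differs from that of M₀ only on H itself, so an algorithm has to ask
-- about each of the 2^(m-1) odd transversals before it may answer that no solution exists.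
module Submission where

open import Defs
open import Level using (Level; lift)
open import Function using (_∘_)
open import Data.Nat using (ℕ; zero; suc; _≤_; _<_; z≤n; s≤s; z<s; s<s; s<s⁻¹; _+_; _*_; _^_; _/_; _<?_)
open import Data.Nat.Properties
  using (≤-trans; ≤-reflexive; ≤-antisym; ≤-pred; <⇒≤; ≮⇒≥; <⇒≢; <-≤-trans; +-monoˡ-≤; +-identityʳ; ^-monoʳ-≤;
         module ≤-Reasoning)
open import Data.Nat.DivMod using (m<n*o⇒m/o<n)
open import Data.Bool using (Bool; true; false; not; _∧_; _xor_; if_then_else_)
open import Data.Bool.Properties
  using (∨-identityʳ; ∧-identityʳ; ∧-zeroʳ; not-involutive; not-injective; ¬-not) renaming (_≟_ to _≟ᵇ_)
open import Data.Fin using (Fin; zero; suc)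
import Data.Fin as Fin
open import Data.Fin.Properties using (injective⇒≤)
open import Data.Fin.Subset using (Subset; ⊥; ⁅_⁆; _∈_; _∉_; _⊆_; _∪_; ∣_∣; inside; outside)
open import Data.Fin.Subset.Properties
  using (∪-identityʳ; p⊆p∪q; q⊆p∪q; x∈⁅x⁆; ∣⊥∣≡0; drop-there; drop-∷-⊆)
open import Data.Vec using ([]; _∷_; here; there; tail)
open import Data.Vec.Properties using (≡-dec)
open import Data.List using (List; []; _∷_; map; _++_; length; lookup)
open import Data.List.Properties using (length-map; length-++)
open import Data.List.Membership.Propositional using () renaming (_∈_ to _∈ₗ_)
open import Data.List.Membership.Propositional.Properties using (∈-lookup; ∈-map⁻)
open import Data.List.Relation.Unary.Any using (index) renaming (here to hereₗ; there to thereₗ)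
open import Data.List.Relation.Unary.Any.Properties using (lookup-index)
open import Data.List.Relation.Unary.All using (All; []; _∷_) renaming (lookup to lookupₐ)
import Data.List.Relation.Unary.All as All
import Data.List.Relation.Unary.All.Properties as All
open import Data.List.Relation.Unary.Unique.Propositional using (Unique; []; _∷_)
import Data.List.Relation.Unary.Unique.Propositional.Properties as Unique
open import Data.Maybe using (just; nothing)
open import Data.Product using (Σ; ∃; _×_; _,_; proj₁; proj₂)
open import Function.Definitions using (Injective)
open import Relation.Binary.Definitions using (DecidableEquality)
open import Relation.Binary.PropositionalEquality
  using (_≡_; _≢_; refl; sym; trans; cong; cong₂; subst; module ≡-Reasoning)
open import Relation.Nullary using (¬_; yes; no; does; contradiction)
open import Relation.Nullary.Decidable using (decidable-stable)
open import Algebra.Bundles using (AbelianGroup)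

∧-true⁻ : ∀ x {y} → x ∧ y ≡ true → x ≡ true × y ≡ true
∧-true⁻ true y≡true = refl , y≡true

_≟ₛ_ : ∀ {n} → DecidableEquality (Subset n)
_≟ₛ_ = ≡-dec _≟ᵇ_

∪-⁅suc⁆ : ∀ {n} x (p : Subset n) i → (x ∷ p) ∪ ⁅ suc i ⁆ ≡ x ∷ (p ∪ ⁅ i ⁆)
∪-⁅suc⁆ x p i = cong (_∷ p ∪ ⁅ i ⁆) (∨-identityʳ x)

x∈p∪⁅x⁆ : ∀ {n} (p : Subset n) x → x ∈ p ∪ ⁅ x ⁆
x∈p∪⁅x⁆ p x = q⊆p∪q p ⁅ x ⁆ (x∈⁅x⁆ x)

there-∃ : ∀ {n s t} {p q : Subset n} →
          (∃ λ x → x ∈ q × x ∉ p) → ∃ λ x → x ∈ t ∷ q × x ∉ s ∷ p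
there-∃ (x , x∈q , x∉p) = suc x , there x∈q , x∉p ∘ drop-there

∣p∪⁅x⁆∣≡1+∣p∣ : ∀ {n} {p : Subset n} {x} → x ∉ p → ∣ p ∪ ⁅ x ⁆ ∣ ≡ suc ∣ p ∣
∣p∪⁅x⁆∣≡1+∣p∣ {p = inside  ∷ p} {zero}  x∉p = contradiction here x∉p
∣p∪⁅x⁆∣≡1+∣p∣ {p = outside ∷ p} {zero}  _   = cong (suc ∘ ∣_∣) (∪-identityʳ p)
∣p∪⁅x⁆∣≡1+∣p∣ {p = inside  ∷ p} {suc x} x∉p = cong suc (∣p∪⁅x⁆∣≡1+∣p∣ (x∉p ∘ there))
∣p∪⁅x⁆∣≡1+∣p∣ {p = outside ∷ p} {suc x} x∉p = ∣p∪⁅x⁆∣≡1+∣p∣ (x∉p ∘ there)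

∃∈q∉p : ∀ {n} {p q : Subset n} → ∣ p ∣ ≤ ∣ q ∣ → p ≢ q → ∃ λ x → x ∈ q × x ∉ p
∃∈q∉p {p = []}          {[]}          _       p≢q = contradiction refl p≢q
∃∈q∉p {p = outside ∷ p} {inside  ∷ q} _       _   = zero , here , λ ()
∃∈q∉p {p = inside  ∷ p} {outside ∷ q} ∣p∣<∣q∣ _   =
  there-∃ (∃∈q∉p (<⇒≤ ∣p∣<∣q∣) (<⇒≢ ∣p∣<∣q∣ ∘ cong ∣_∣))
∃∈q∉p {p = inside  ∷ p} {inside  ∷ q} ∣p∣≤∣q∣ p≢q =
  there-∃ (∃∈q∉p (≤-pred ∣p∣≤∣q∣) (p≢q ∘ cong (inside ∷_)))
∃∈q∉p {p = outside ∷ p} {outside ∷ q} ∣p∣≤∣q∣ p≢q =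
  there-∃ (∃∈q∉p ∣p∣≤∣q∣ (p≢q ∘ cong (outside ∷_)))

∃∈q∉p-< : ∀ {n} {p q : Subset n} → ∣ p ∣ < ∣ q ∣ → ∃ λ x → x ∈ q × x ∉ p
∃∈q∉p-< ∣p∣<∣q∣ = ∃∈q∉p (<⇒≤ ∣p∣<∣q∣) (<⇒≢ ∣p∣<∣q∣ ∘ cong ∣_∣)

p⊆q∧∣q∣≤∣p∣⇒p≡q : ∀ {n} {p q : Subset n} → p ⊆ q → ∣ q ∣ ≤ ∣ p ∣ → p ≡ q
p⊆q∧∣q∣≤∣p∣⇒p≡q {p = p} {q} p⊆q ∣q∣≤∣p∣ = decidable-stable (p ≟ₛ q) λ p≢q →
  let x , x∈p , x∉q = ∃∈q∉p ∣q∣≤∣p∣ (p≢q ∘ sym) in x∉q (p⊆q x∈p)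

Augmenting : ∀ {n} → (Subset n → Bool) → Subset n → Subset n → Set
Augmenting {n} independent X Y = Σ (Fin n) λ e → e ∈ Y × e ∉ X × independent (X ∪ ⁅ e ⁆) ≡ true

-- Sparse paving: no two members F₁, F₂ of the family have |F₁ △ F₂| = 2.
Sparse : ∀ {n} → (Subset n → Bool) → Set
Sparse F = ∀ X {x y} → x ∉ X → y ∉ X → x ≢ y → ¬ (F (X ∪ ⁅ x ⁆) ≡ true × F (X ∪ ⁅ y ⁆) ≡ true)

Sparse-mono : ∀ {n} {F G : Subset n → Bool} →
              (∀ X → G X ≡ true → F X ≡ true) → Sparse F → Sparse G
Sparse-mono G⇒F sparseF X x∉X y∉X x≢y (Gx , Gy) = sparseF X x∉X y∉X x≢y (G⇒F _ Gx , G⇒F _ Gy)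

relax : ∀ {n} → (Subset n → Bool) → Subset n → Subset n → Bool
relax F H X = F X ∧ not (does (X ≟ₛ H))

relax-self : ∀ {n} (F : Subset n → Bool) H → relax F H H ≡ false
relax-self F H with H ≟ₛ H
... | yes _   = ∧-zeroʳ (F H)
... | no H≢H = contradiction refl H≢H

relax-≢ : ∀ {n} (F : Subset n → Bool) {H X} → X ≢ H → relax F H X ≡ F X
relax-≢ F {H} {X} X≢H with X ≟ₛ H
... | yes X≡H = contradiction X≡H X≢H
... | no _    = ∧-identityʳ (F X)

relax⇒ : ∀ {n} (F : Subset n → Bool) H X → relax F H X ≡ true → F X ≡ true
relax⇒ F H X = proj₁ ∘ ∧-true⁻ (F X)

-- Independence of a k-set in a paving matroid of rank r: k < r, or k = r and the set is not a
-- circuit-hyperplane (c = false).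
withinRank : ℕ → ℕ → Bool → Bool
withinRank zero    zero    c = not c
withinRank zero    (suc k) c = false
withinRank (suc r) zero    c = true
withinRank (suc r) (suc k) c = withinRank r k c

withinRank-< : ∀ {r k} c → k < r → withinRank r k c ≡ true
withinRank-< {suc r} {zero}  c _         = refl
withinRank-< {suc r} {suc k} c (s<s k<r) = withinRank-< c k<r

withinRank-≡ : ∀ r c → withinRank r r c ≡ not c
withinRank-≡ zero    c = refl
withinRank-≡ (suc r) c = withinRank-≡ r c

withinRank-> : ∀ {r k} c → r < k → withinRank r k c ≡ false
withinRank-> {zero}  {suc k} c _         = refl
withinRank-> {suc r} {suc k} c (s<s r<k) = withinRank-> c r<k

withinRank⇒≤ : ∀ {r k c} → withinRank r k c ≡ true → k ≤ r
withinRank⇒≤ {zero}  {zero}  _ = z≤n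
withinRank⇒≤ {suc r} {zero}  _ = z≤n
withinRank⇒≤ {suc r} {suc k} w = s≤s (withinRank⇒≤ {r} {k} w)

module SparsePaving {n : ℕ} (r : ℕ) (F : Subset n → Bool) where

  independent : Subset n → Bool
  independent X = withinRank r ∣ X ∣ (F X)

  independent-belowRank : ∀ {X} → ∣ X ∣ < r → independent X ≡ true
  independent-belowRank {X} = withinRank-< (F X)

  independent-atRank⁺ : ∀ {X} → ∣ X ∣ ≡ r → F X ≡ false → independent X ≡ true
  independent-atRank⁺ {X} refl FX≡false = trans (withinRank-≡ r (F X)) (cong not FX≡false)

  independent-atRank⁻ : ∀ {X} → ∣ X ∣ ≡ r → independent X ≡ true → F X ≡ false
  independent-atRank⁻ {X} refl indX = not-injective (trans (sym (withinRank-≡ r (F X))) indX)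

  dependent-aboveRank : ∀ {X} → r < ∣ X ∣ → independent X ≡ false
  dependent-aboveRank {X} = withinRank-> (F X)

  independent-∅ : 0 < r → independent ⊥ ≡ true
  independent-∅ 0<r = independent-belowRank (subst (_< r) (sym (∣⊥∣≡0 n)) 0<r)

  independent-hereditary : ∀ {X Y} → X ⊆ Y → independent Y ≡ true → independent X ≡ true
  independent-hereditary {X} {Y} X⊆Y indY with ∣ X ∣ <? r
  ... | yes ∣X∣<r = independent-belowRank ∣X∣<r
  ... | no ∣X∣≮r  = subst (λ Z → independent Z ≡ true) (sym X≡Y) indY
    where
    X≡Y : X ≡ Y
    X≡Y = p⊆q∧∣q∣≤∣p∣⇒p≡q X⊆Y (≤-trans (withinRank⇒≤ indY) (≮⇒≥ ∣X∣≮r))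

  -- If X ∪ {x} is a circuit-hyperplane, then Y ≠ X ∪ {x} has an element y outside X ∪ {x},
  -- and by sparseness X ∪ {y} is not a circuit-hyperplane.
  augmentAtRank : Sparse F → ∀ {X Y x} → independent Y ≡ true → ∣ Y ∣ ≡ r →
                  (∀ {z} → z ∉ X → ∣ X ∪ ⁅ z ⁆ ∣ ≡ r) → x ∈ Y → x ∉ X → Augmenting independent X Y
  augmentAtRank sparse {X} {Y} {x} indY ∣Y∣≡r ∣X∪z∣≡r x∈Y x∉X with F (X ∪ ⁅ x ⁆) in Fx
  ... | false = x , x∈Y , x∉X , independent-atRank⁺ (∣X∪z∣≡r x∉X) Fx
  ... | true with ∃∈q∉p (≤-reflexive (trans (∣X∪z∣≡r x∉X) (sym ∣Y∣≡r))) X∪x≢Y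
    where
    X∪x≢Y : X ∪ ⁅ x ⁆ ≢ Y
    X∪x≢Y refl = contradiction (trans (sym Fx) (independent-atRank⁻ ∣Y∣≡r indY)) λ ()
  ... | y , y∈Y , y∉X∪x = y , y∈Y , y∉X , independent-atRank⁺ (∣X∪z∣≡r y∉X) Fy≡false
    where
    y∉X : y ∉ X
    y∉X = y∉X∪x ∘ p⊆p∪q ⁅ x ⁆
    x≢y : x ≢ y
    x≢y refl = y∉X∪x (x∈p∪⁅x⁆ X x)
    Fy≡false : F (X ∪ ⁅ y ⁆) ≡ false
    Fy≡false = ¬-not λ Fy → sparse X x∉X y∉X x≢y (Fx , Fy)

  independent-augment : Sparse F → ∀ {X Y} → independent X ≡ true → independent Y ≡ true →
                        ∣ X ∣ < ∣ Y ∣ → Augmenting independent X Y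
  independent-augment sparse {X} {Y} _ indY ∣X∣<∣Y∣ with ∃∈q∉p-< ∣X∣<∣Y∣ | suc ∣ X ∣ <? r
  ... | x , x∈Y , x∉X | yes 1+∣X∣<r =
    x , x∈Y , x∉X , independent-belowRank (subst (_< r) (sym (∣p∪⁅x⁆∣≡1+∣p∣ x∉X)) 1+∣X∣<r)
  ... | x , x∈Y , x∉X | no 1+∣X∣≮r =
    augmentAtRank sparse indY ∣Y∣≡r (λ z∉X → trans (∣p∪⁅x⁆∣≡1+∣p∣ z∉X) 1+∣X∣≡r) x∈Y x∉X
    where
    ∣Y∣≤r : ∣ Y ∣ ≤ r
    ∣Y∣≤r = withinRank⇒≤ indY
    r≤1+∣X∣ : r ≤ suc ∣ X ∣
    r≤1+∣X∣ = ≮⇒≥ 1+∣X∣≮r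
    1+∣X∣≡r : suc ∣ X ∣ ≡ r
    1+∣X∣≡r = ≤-antisym (≤-trans ∣X∣<∣Y∣ ∣Y∣≤r) r≤1+∣X∣
    ∣Y∣≡r : ∣ Y ∣ ≡ r
    ∣Y∣≡r = ≤-antisym ∣Y∣≤r (≤-trans r≤1+∣X∣ ∣X∣<∣Y∣)

  matroid : 0 < r → Sparse F → Matroid n
  matroid 0<r sparse = record
    { indep      = independent
    ; indep-∅    = independent-∅ 0<r
    ; hereditary = independent-hereditary
    ; augment    = independent-augment sparse
    }

  atRank⇒basis : ∀ 0<r sparse {X} → ∣ X ∣ ≡ r → F X ≡ false → IsBasis (matroid 0<r sparse) X
  atRank⇒basis _ _ ∣X∣≡r FX≡false =
    independent-atRank⁺ ∣X∣≡r FX≡false ,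
    λ e e∉X → dependent-aboveRank (≤-reflexive (sym (trans (∣p∪⁅x⁆∣≡1+∣p∣ e∉X) (cong suc ∣X∣≡r))))

-- The ground set Fin n is cut into the pairs {2i, 2i+1}; if n is odd, its last element is a loop.
pairs : ℕ → ℕ
pairs zero          = zero
pairs (suc zero)    = zero
pairs (suc (suc n)) = suc (pairs n)

pairIndependent : ∀ {n} → Subset n → Bool
pairIndependent []          = true
pairIndependent (x ∷ [])    = not x
pairIndependent (x ∷ y ∷ X) = not (x ∧ y) ∧ pairIndependent X

transversal : ∀ {n} → Subset n → Bool
transversal []          = true
transversal (x ∷ [])    = not x
transversal (x ∷ y ∷ X) = (x xor y) ∧ transversal X

parity : ∀ {n} → Subset n → Bool
parity []          = false
parity (x ∷ [])    = false
parity (x ∷ y ∷ X) = x xor parity X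

pairIndependent-⊥ : ∀ n → pairIndependent (⊥ {n}) ≡ true
pairIndependent-⊥ zero          = refl
pairIndependent-⊥ (suc zero)    = refl
pairIndependent-⊥ (suc (suc n)) = pairIndependent-⊥ n

pairHereditary : ∀ {n} {X Y : Subset n} → X ⊆ Y → pairIndependent Y ≡ true → pairIndependent X ≡ true
pairHereditary {X = []}                                   _   _    = refl
pairHereditary {X = outside ∷ []}                         _   _    = refl
pairHereditary {X = inside ∷ []}  {inside ∷ []}           _   ()
pairHereditary {X = inside ∷ []}  {outside ∷ []}          X⊆Y _    = contradiction (X⊆Y here) λ ()
pairHereditary {X = inside ∷ inside ∷ _} {y ∷ y′ ∷ _}     X⊆Y indY with X⊆Y here | X⊆Y (there here)
pairHereditary {X = inside ∷ inside ∷ _} {inside ∷ inside ∷ _} _ () | here | there here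
pairHereditary {X = inside ∷ outside ∷ _} {y ∷ y′ ∷ _}    X⊆Y indY =
  pairHereditary (drop-∷-⊆ (drop-∷-⊆ X⊆Y)) (proj₂ (∧-true⁻ (not (y ∧ y′)) indY))
pairHereditary {X = outside ∷ _ ∷ _} {y ∷ y′ ∷ _}         X⊆Y indY =
  pairHereditary (drop-∷-⊆ (drop-∷-⊆ X⊆Y)) (proj₂ (∧-true⁻ (not (y ∧ y′)) indY))

shiftAugmenting : ∀ {n} {X Y : Subset n} x x′ y y′ → not (x ∧ x′) ≡ true →
                  Augmenting pairIndependent X Y → Augmenting pairIndependent (x ∷ x′ ∷ X) (y ∷ y′ ∷ Y)
shiftAugmenting {X = X} x x′ _ _ head (e , e∈Y , e∉X , indX∪e) =
  suc (suc e) , there (there e∈Y) , (λ { (there (there e∈X)) → e∉X e∈X }) ,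
  subst (λ Z → pairIndependent Z ≡ true) (sym X∪e≡) (cong₂ _∧_ head indX∪e)
  where
  X∪e≡ : (x ∷ x′ ∷ X) ∪ ⁅ suc (suc e) ⁆ ≡ x ∷ x′ ∷ (X ∪ ⁅ e ⁆)
  X∪e≡ = trans (∪-⁅suc⁆ x (x′ ∷ X) (suc e)) (cong (x ∷_) (∪-⁅suc⁆ x′ X e))

drop-pair-< : ∀ {n} {p q : Subset n} y y′ → pairIndependent (y ∷ y′ ∷ q) ≡ true →
              suc ∣ p ∣ < ∣ y ∷ y′ ∷ q ∣ → ∣ p ∣ < ∣ q ∣
drop-pair-< outside outside _ = <⇒≤
drop-pair-< outside inside  _ = s<s⁻¹
drop-pair-< inside  outside _ = s<s⁻¹
drop-pair-< inside  inside  ()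

-- If X misses a pair in which Y has an element, that element is added; otherwise the first pair
-- contributes to ∣ X ∣ at least as much as to ∣ Y ∣, and the rest of X augments from the rest of Y.
pairAugment : ∀ {n} {X Y : Subset n} → pairIndependent X ≡ true → pairIndependent Y ≡ true →
              ∣ X ∣ < ∣ Y ∣ → Augmenting pairIndependent X Y
pairAugment {X = []}            {[]}            _ _ ()
pairAugment {X = outside ∷ []}  {outside ∷ []}  _ _ ()
pairAugment {X = outside ∷ []}  {inside ∷ []}   _ () _
pairAugment {X = inside ∷ []}                   () _ _
pairAugment {X = inside ∷ inside ∷ X}           () _ _
pairAugment {X = outside ∷ outside ∷ X} {inside ∷ _ ∷ _} indX _ _ =
  zero , here , (λ ()) , subst (λ Z → pairIndependent Z ≡ true) (sym (∪-identityʳ X)) indX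
pairAugment {X = outside ∷ outside ∷ X} {outside ∷ inside ∷ _} indX _ _ =
  suc zero , there here , (λ { (there ()) }) ,
  subst (λ Z → pairIndependent Z ≡ true) (sym (∪-identityʳ X)) indX
pairAugment {X = outside ∷ outside ∷ _} {outside ∷ outside ∷ _} indX indY ∣X∣<∣Y∣ =
  shiftAugmenting outside outside outside outside refl (pairAugment indX indY ∣X∣<∣Y∣)
pairAugment {X = inside ∷ outside ∷ X} {y ∷ y′ ∷ Y} indX indY ∣X∣<∣Y∣ =
  shiftAugmenting inside outside y y′ refl
    (pairAugment indX (proj₂ (∧-true⁻ _ indY)) (drop-pair-< {p = X} {Y} y y′ indY ∣X∣<∣Y∣))
pairAugment {X = outside ∷ inside ∷ X} {y ∷ y′ ∷ Y} indX indY ∣X∣<∣Y∣ =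
  shiftAugmenting outside inside y y′ refl
    (pairAugment indX (proj₂ (∧-true⁻ _ indY)) (drop-pair-< {p = X} {Y} y y′ indY ∣X∣<∣Y∣))

pairMatroid : ∀ {n} → Matroid n
pairMatroid {n} = record
  { indep      = pairIndependent
  ; indep-∅    = pairIndependent-⊥ n
  ; hereditary = pairHereditary
  ; augment    = pairAugment
  }

∣transversal∣≡pairs : ∀ {n} (H : Subset n) → transversal H ≡ true → ∣ H ∣ ≡ pairs n
∣transversal∣≡pairs []                    _ = refl
∣transversal∣≡pairs (outside ∷ [])        _ = refl
∣transversal∣≡pairs (inside ∷ outside ∷ H) t = cong suc (∣transversal∣≡pairs H t)
∣transversal∣≡pairs (outside ∷ inside ∷ H) t = cong suc (∣transversal∣≡pairs H t)

transversal⇒pairIndependent : ∀ {n} (H : Subset n) → transversal H ≡ true → pairIndependent H ≡ true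
transversal⇒pairIndependent []                    _ = refl
transversal⇒pairIndependent (outside ∷ [])        _ = refl
transversal⇒pairIndependent (inside ∷ outside ∷ H) t = transversal⇒pairIndependent H t
transversal⇒pairIndependent (outside ∷ inside ∷ H) t = transversal⇒pairIndependent H t

transversal-maximal : ∀ {n} (H : Subset n) e → transversal H ≡ true → e ∉ H →
                      pairIndependent (H ∪ ⁅ e ⁆) ≡ false
transversal-maximal (outside ∷ [])        zero          _ _   = refl
transversal-maximal (inside ∷ outside ∷ H) zero          _ e∉H = contradiction here e∉H
transversal-maximal (outside ∷ inside ∷ H) zero          _ _   = refl
transversal-maximal (inside ∷ outside ∷ H) (suc zero)    _ _   = refl
transversal-maximal (outside ∷ inside ∷ H) (suc zero)    _ e∉H = contradiction (there here) e∉H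
transversal-maximal (inside ∷ outside ∷ H) (suc (suc e)) t e∉H =
  transversal-maximal H e t (e∉H ∘ there ∘ there)
transversal-maximal (outside ∷ inside ∷ H) (suc (suc e)) t e∉H =
  transversal-maximal H e t (e∉H ∘ there ∘ there)

transversal⇒basis : ∀ {n} (H : Subset n) → transversal H ≡ true → IsBasis pairMatroid H
transversal⇒basis H t = transversal⇒pairIndependent H t , λ e → transversal-maximal H e t

nonTransversal-extends : ∀ {n} (B : Subset n) → pairIndependent B ≡ true → transversal B ≡ false →
                         ∃ λ e → e ∉ B × pairIndependent (B ∪ ⁅ e ⁆) ≡ true
nonTransversal-extends (outside ∷ outside ∷ B) indB _ =
  zero , (λ ()) , subst (λ Z → pairIndependent (inside ∷ outside ∷ Z) ≡ true) (sym (∪-identityʳ B)) indB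
nonTransversal-extends (inside ∷ outside ∷ B) indB t with nonTransversal-extends B indB t
... | e , e∉B , indB∪e = suc (suc e) , (λ { (there (there e∈B)) → e∉B e∈B }) , indB∪e
nonTransversal-extends (outside ∷ inside ∷ B) indB t with nonTransversal-extends B indB t
... | e , e∉B , indB∪e = suc (suc e) , (λ { (there (there e∈B)) → e∉B e∈B }) , indB∪e

basis⇒transversal : ∀ {n} (B : Subset n) → IsBasis pairMatroid B → transversal B ≡ true
basis⇒transversal B (indB , maximal) with transversal B in tB
... | true  = refl
... | false with nonTransversal-extends B indB tB
...   | e , e∉B , indB∪e = contradiction (trans (sym indB∪e) (maximal e e∉B)) λ ()

oddTransversal : ∀ {n} → Subset n → Bool
oddTransversal X = transversal X ∧ parity X

-- Both X ∪ {x} and X ∪ {y} being transversals forces {x, y} to be one of the pairs, so exactly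
-- one of x, y is a first element.
transversal-exchange : ∀ {n} (X : Subset n) {x y} → x ∉ X → y ∉ X → x ≢ y →
                       transversal (X ∪ ⁅ x ⁆) ≡ true → transversal (X ∪ ⁅ y ⁆) ≡ true →
                       parity (X ∪ ⁅ x ⁆) ≡ not (parity (X ∪ ⁅ y ⁆))
transversal-exchange (inside ∷ _)      {zero}          x∉X _   _   _ _ = contradiction here x∉X
transversal-exchange (inside ∷ _)      {y = zero}      _   y∉X _   _ _ = contradiction here y∉X
transversal-exchange (_ ∷ inside ∷ _)  {suc zero}      x∉X _   _   _ _ = contradiction (there here) x∉X
transversal-exchange (_ ∷ inside ∷ _)  {y = suc zero}  _   y∉X _   _ _ = contradiction (there here) y∉X
transversal-exchange (_ ∷ _)           {zero} {zero}   _   _   x≢y _ _ = contradiction refl x≢y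
transversal-exchange (_ ∷ _ ∷ _) {suc zero} {suc zero} _   _   x≢y _ _ = contradiction refl x≢y
transversal-exchange (outside ∷ outside ∷ X) {zero} {suc zero} _ _ _ _ _ = refl
transversal-exchange (outside ∷ outside ∷ X) {suc zero} {zero} _ _ _ _ _ = sym (not-involutive _)
transversal-exchange (inside ∷ outside ∷ X) {suc (suc x)} {suc (suc y)} x∉X y∉X x≢y tx ty =
  cong not (transversal-exchange X (x∉X ∘ there ∘ there) (y∉X ∘ there ∘ there)
                                   (x≢y ∘ cong (Fin.suc ∘ Fin.suc)) tx ty)
transversal-exchange (outside ∷ inside ∷ X) {suc (suc x)} {suc (suc y)} x∉X y∉X x≢y tx ty =
  transversal-exchange X (x∉X ∘ there ∘ there) (y∉X ∘ there ∘ there)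
                         (x≢y ∘ cong (Fin.suc ∘ Fin.suc)) tx ty
transversal-exchange (outside ∷ outside ∷ X) {zero}          {suc (suc y)} _ _ _ _  ()
transversal-exchange (outside ∷ outside ∷ X) {suc zero}      {suc (suc y)} _ _ _ _  ()
transversal-exchange (outside ∷ outside ∷ X) {suc (suc x)}   {_}           _ _ _ () _
transversal-exchange (outside ∷ inside ∷ X)  {zero}          {suc (suc y)} _ _ _ () _
transversal-exchange (outside ∷ inside ∷ X)  {suc (suc x)}   {zero}        _ _ _ _  ()
transversal-exchange (inside ∷ outside ∷ X)  {suc zero}      {suc (suc y)} _ _ _ () _
transversal-exchange (inside ∷ outside ∷ X)  {suc (suc x)}   {suc zero}    _ _ _ _  ()
transversal-exchange (inside ∷ inside ∷ X)   {suc (suc x)}   {suc (suc y)} _ _ _ () _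

oddTransversal-sparse : ∀ {n} → Sparse (oddTransversal {n})
oddTransversal-sparse X x∉X y∉X x≢y (oddX∪x , oddX∪y) =
  let tx , px = ∧-true⁻ _ oddX∪x
      ty , py = ∧-true⁻ _ oddX∪y
  in contradiction (trans (sym px) (trans (transversal-exchange X x∉X y∉X x≢y tx ty) (cong not py))) λ ()

pickFirst pickSecond : ∀ {n} → Subset n → Subset (suc (suc n))
pickFirst  H = inside ∷ outside ∷ H
pickSecond H = outside ∷ inside ∷ H

transversals : ∀ n → List (Subset n)
transversals zero          = [] ∷ []
transversals (suc zero)    = (outside ∷ []) ∷ []
transversals (suc (suc n)) = map pickFirst (transversals n) ++ map pickSecond (transversals n)

transversals-transversal : ∀ n → All (λ H → transversal H ≡ true) (transversals n)
transversals-transversal zero          = refl ∷ []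
transversals-transversal (suc zero)    = refl ∷ []
transversals-transversal (suc (suc n)) =
  All.++⁺ (All.map⁺ (transversals-transversal n)) (All.map⁺ (transversals-transversal n))

transversals-unique : ∀ n → Unique (transversals n)
transversals-unique zero          = [] ∷ []
transversals-unique (suc zero)    = [] ∷ []
transversals-unique (suc (suc n)) =
  Unique.++⁺ (Unique.map⁺ (cong (tail ∘ tail)) (transversals-unique n))
             (Unique.map⁺ (cong (tail ∘ tail)) (transversals-unique n))
             firstsDisjointFromSeconds
  where
  firstsDisjointFromSeconds : ∀ {H} → ¬ (H ∈ₗ map pickFirst (transversals n) ×
                                         H ∈ₗ map pickSecond (transversals n))
  firstsDisjointFromSeconds (H∈firsts , H∈seconds)
    with ∈-map⁻ pickFirst H∈firsts | ∈-map⁻ pickSecond H∈seconds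
  ... | _ , _ , refl | _ , _ , ()

length-transversals : ∀ n → length (transversals n) ≡ 2 ^ pairs n
length-transversals zero          = refl
length-transversals (suc zero)    = refl
length-transversals (suc (suc n)) = begin
  length (map pickFirst Ts ++ map pickSecond Ts)
    ≡⟨ length-++ (map pickFirst Ts) ⟩
  length (map pickFirst Ts) + length (map pickSecond Ts)
    ≡⟨ cong₂ _+_ (length-map pickFirst Ts) (length-map pickSecond Ts) ⟩
  length Ts + length Ts
    ≡⟨ cong (λ k → k + k) (length-transversals n) ⟩
  2 ^ pairs n + 2 ^ pairs n
    ≡⟨ cong (2 ^ pairs n +_) (sym (+-identityʳ _)) ⟩
  2 ^ pairs (suc (suc n))
    ∎
  where
  open ≡-Reasoning
  Ts = transversals n

oddExtension : ∀ {n} → Subset n → Subset (suc (suc n))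
oddExtension H = if parity H then pickSecond H else pickFirst H

oddExtension-odd : ∀ {n} (H : Subset n) → transversal H ≡ true → oddTransversal (oddExtension H) ≡ true
oddExtension-odd H tH with parity H in pH
... | true  = cong₂ _∧_ tH pH
... | false = cong₂ _∧_ tH (cong not pH)

tail₂-oddExtension : ∀ {n} (H : Subset n) → tail (tail (oddExtension H)) ≡ H
tail₂-oddExtension H with parity H
... | true  = refl
... | false = refl

oddExtension-injective : ∀ {n} {H H′ : Subset n} → oddExtension H ≡ oddExtension H′ → H ≡ H′
oddExtension-injective {H = H} {H′} eq = begin
  H                             ≡⟨ sym (tail₂-oddExtension H) ⟩
  tail (tail (oddExtension H))  ≡⟨ cong (tail ∘ tail) eq ⟩
  tail (tail (oddExtension H′)) ≡⟨ tail₂-oddExtension H′ ⟩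
  H′                            ∎
  where open ≡-Reasoning

oddTransversals : ∀ n → List (Subset (suc (suc n)))
oddTransversals n = map oddExtension (transversals n)

oddTransversals-odd : ∀ n → All (λ H → oddTransversal H ≡ true) (oddTransversals n)
oddTransversals-odd n = All.map⁺ (All.map (λ {H} → oddExtension-odd H) (transversals-transversal n))

oddTransversals-unique : ∀ n → Unique (oddTransversals n)
oddTransversals-unique n = Unique.map⁺ oddExtension-injective (transversals-unique n)

length-oddTransversals : ∀ n → length (oddTransversals n) ≡ 2 ^ pairs n
length-oddTransversals n = trans (length-map oddExtension (transversals n)) (length-transversals n)

Unique-lookup-injective : ∀ {a} {A : Set a} {xs : List A} → Unique xs → Injective _≡_ _≡_ (lookup xs)
Unique-lookup-injective (_ ∷ _)      {zero}  {zero}  _       = refl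
Unique-lookup-injective (x∉xs ∷ _)   {zero}  {suc j} x≡xs[j] = contradiction x≡xs[j] (lookupₐ x∉xs (∈-lookup j))
Unique-lookup-injective (x∉xs ∷ _)   {suc i} {zero}  xs[i]≡x = contradiction (sym xs[i]≡x) (lookupₐ x∉xs (∈-lookup i))
Unique-lookup-injective (_ ∷ unique) {suc i} {suc j} eq      = cong suc (Unique-lookup-injective unique eq)

Unique-⊆⇒length≤ : ∀ {a} {A : Set a} {xs ys : List A} → Unique xs → (∀ {x} → x ∈ₗ xs → x ∈ₗ ys) →
                   length xs ≤ length ys
Unique-⊆⇒length≤ {xs = xs} {ys} uniqueXs xs⊆ys = injective⇒≤ position-injective
  where
  position : Fin (length xs) → Fin (length ys)
  position i = index (xs⊆ys (∈-lookup i))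
  lookup-position : ∀ i → lookup ys (position i) ≡ lookup xs i
  lookup-position i = sym (lookup-index (xs⊆ys (∈-lookup i)))
  position-injective : Injective _≡_ _≡_ position
  position-injective {i} {j} eq = Unique-lookup-injective uniqueXs
    (trans (sym (lookup-position i)) (trans (cong (lookup ys) eq) (lookup-position j)))

queried : ∀ {n} → QueryTree n → Matroid n → Matroid n → List (Subset n)
queried (answer _)    M₁ M₂ = []
queried (query w S k) M₁ M₂ = S ∷ queried (k (oracle M₁ M₂ w S)) M₁ M₂

length-queried : ∀ {n} (T : QueryTree n) M₁ M₂ → length (queried T M₁ M₂) ≡ queries T M₁ M₂
length-queried (answer _)    _  _  = refl
length-queried (query w S k) M₁ M₂ = cong suc (length-queried (k (oracle M₁ M₂ w S)) M₁ M₂)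

run-differs⇒queried : ∀ {n} (T : QueryTree n) M₁ {M₂ M₂′ : Matroid n} {H} →
                      (∀ S → S ≢ H → indep M₂′ S ≡ indep M₂ S) → run T M₁ M₂′ ≢ run T M₁ M₂ →
                      H ∈ₗ queried T M₁ M₂
run-differs⇒queried (answer _) _ _ differ = contradiction refl differ
run-differs⇒queried (query w S k) M₁ {M₂} {M₂′} {H} agree differ with S ≟ₛ H
... | yes refl = hereₗ refl
... | no S≢H   = thereₗ (run-differs⇒queried (k (oracle M₁ M₂ w S)) M₁ agree
                          (differ ∘ trans (cong (λ b → run (k b) M₁ M₂′) (sameAnswer w))))
  where
  sameAnswer : ∀ w → oracle M₁ M₂′ w S ≡ oracle M₁ M₂ w S
  sameAnswer false = refl
  sameAnswer true  = agree S S≢H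

distinguished≤queries : ∀ {n} (T : QueryTree n) M₁ M₂ (M₂′ : Subset n → Matroid n) {Hs} →
                        Unique Hs → (∀ H S → S ≢ H → indep (M₂′ H) S ≡ indep M₂ S) →
                        All (λ H → run T M₁ (M₂′ H) ≢ run T M₁ M₂) Hs →
                        length Hs ≤ queries T M₁ M₂
distinguished≤queries T M₁ M₂ M₂′ {Hs} uniqueHs agree differ = begin
  length Hs                ≤⟨ Unique-⊆⇒length≤ uniqueHs Hs⊆queried ⟩
  length (queried T M₁ M₂) ≡⟨ length-queried T M₁ M₂ ⟩
  queries T M₁ M₂          ∎
  where
  open ≤-Reasoning
  Hs⊆queried : ∀ {H} → H ∈ₗ Hs → H ∈ₗ queried T M₁ M₂
  Hs⊆queried H∈Hs = run-differs⇒queried T M₁ (agree _) (lookupₐ differ H∈Hs)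

2+n<[1+pairs]*4 : ∀ n → 2 + n < suc (pairs n) * 4
2+n<[1+pairs]*4 zero          = s<s (s<s z<s)
2+n<[1+pairs]*4 (suc zero)    = s<s (s<s (s<s z<s))
2+n<[1+pairs]*4 (suc (suc n)) =
  <-≤-trans (s<s (s<s (2+n<[1+pairs]*4 n))) (+-monoˡ-≤ (suc (pairs n) * 4) {2} {4} (s≤s (s≤s z≤n)))

[2+n]/4≤pairs : ∀ n → (2 + n) / 4 ≤ pairs n
[2+n]/4≤pairs n = ≤-pred (m<n*o⇒m/o<n (2+n<[1+pairs]*4 n))

module HardInstance {c ℓ : Level} (Γ : AbelianGroup c ℓ) (g : AbelianGroup.Carrier Γ)
                    (g≉ε : ¬ AbelianGroup._≈_ Γ g (AbelianGroup.ε Γ))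
                    (g∙g≈ε : AbelianGroup._≈_ Γ (AbelianGroup._∙_ Γ g g) (AbelianGroup.ε Γ)) where
  open AbelianGroup Γ using (Carrier; _≈_; _∙_; ε; identityˡ; identityʳ; ∙-congˡ)
    renaming (trans to ≈-trans; sym to ≈-sym; refl to ≈-refl)

  label : ∀ n → Fin n → Carrier
  label (suc zero)    zero          = ε
  label (suc (suc n)) zero          = g
  label (suc (suc n)) (suc zero)    = ε
  label (suc (suc n)) (suc (suc i)) = label n i

  g^ : Bool → Carrier
  g^ b = if b then g else ε

  g∙g^ : ∀ b → g ∙ g^ b ≈ g^ (not b)
  g∙g^ true  = g∙g≈ε
  g∙g^ false = identityʳ g

  sumOver-label : ∀ {n} (B : Subset n) → transversal B ≡ true → sumOver Γ (label n) B ≈ g^ (parity B)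
  sumOver-label []                     _  = ≈-refl
  sumOver-label (outside ∷ [])         _  = ≈-refl
  sumOver-label (inside ∷ outside ∷ B) tB = ≈-trans (∙-congˡ (sumOver-label B tB)) (g∙g^ (parity B))
  sumOver-label (outside ∷ inside ∷ B) tB = ≈-trans (identityˡ _) (sumOver-label B tB)

  module _ (n : ℕ) where

    rank : ℕ
    rank = pairs (suc (suc n))

    M₁ M₀ : Matroid (suc (suc n))
    M₁ = pairMatroid
    M₀ = SparsePaving.matroid rank oddTransversal z<s oddTransversal-sparse

    relaxed-sparse : ∀ {H : Subset (suc (suc n))} → Sparse (relax oddTransversal H)
    relaxed-sparse {H} = Sparse-mono (relax⇒ oddTransversal H) oddTransversal-sparse

    relaxed : Subset (suc (suc n)) → Matroid (suc (suc n))
    relaxed H = SparsePaving.matroid rank (relax oddTransversal H) z<s relaxed-sparse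

    noSolution : ∀ B → ¬ IsNonZeroCommonBasis Γ M₁ M₀ (label _) B
    noSolution B (lift (basis₁ , indB₀ , _) , sum≉ε) =
      sum≉ε (subst (λ b → sumOver Γ (label _) B ≈ g^ b) even (sumOver-label B tB))
      where
      tB : transversal B ≡ true
      tB = basis⇒transversal B basis₁
      notOdd : oddTransversal B ≡ false
      notOdd = SparsePaving.independent-atRank⁻ rank oddTransversal {B} (∣transversal∣≡pairs B tB) indB₀
      even : parity B ≡ false
      even = trans (cong (_∧ parity B) (sym tB)) notOdd

    relaxed-solution : ∀ H → oddTransversal H ≡ true → IsNonZeroCommonBasis Γ M₁ (relaxed H) (label _) H
    relaxed-solution H oddH =
      lift (transversal⇒basis H tH , basis₀) , λ sum≈ε → g≉ε (≈-trans (≈-sym sum≈g) sum≈ε)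
      where
      tH : transversal H ≡ true
      tH = proj₁ (∧-true⁻ _ oddH)
      basis₀ : IsBasis (relaxed H) H
      basis₀ = SparsePaving.atRank⇒basis rank (relax oddTransversal H) z<s relaxed-sparse
                 (∣transversal∣≡pairs H tH) (relax-self oddTransversal H)
      sum≈g : sumOver Γ (label _) H ≈ g
      sum≈g = subst (λ b → sumOver Γ (label _) H ≈ g^ b) (proj₂ (∧-true⁻ _ oddH)) (sumOver-label H tH)

    queryLowerBound : (A : Algorithm Γ) → SolvesNZCB Γ A →
                      2 ^ pairs n ≤ queries (A (suc (suc n)) (label _)) M₁ M₀
    queryLowerBound A solves = subst (_≤ queries T M₁ M₀) (length-oddTransversals n)
      (distinguished≤queries T M₁ M₀ relaxed (oddTransversals-unique n) agree
        (All.map (relaxed-distinguished _) (oddTransversals-odd n)))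
      where
      T : QueryTree (suc (suc n))
      T = A (suc (suc n)) (label _)
      agree : ∀ H S → S ≢ H → indep (relaxed H) S ≡ indep M₀ S
      agree H S S≢H = cong (withinRank rank ∣ S ∣) (relax-≢ oddTransversal S≢H)
      answersNothing : run T M₁ M₀ ≡ nothing
      answersNothing with run T M₁ M₀ in out
      ... | nothing = refl
      ... | just B  = contradiction (proj₁ (solves _ (label _) M₁ M₀) B out) (noSolution B)
      relaxed-distinguished : ∀ H → oddTransversal H ≡ true → run T M₁ (relaxed H) ≢ run T M₁ M₀
      relaxed-distinguished H oddH same =
        proj₂ (solves _ (label _) M₁ (relaxed H)) (trans same answersNothing) H (relaxed-solution H oddH)

mainTheorem15 : {c ℓ : Level} (Γ : AbelianGroup c ℓ) → HasElementOfOrderTwo Γ →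
    (A : Algorithm Γ) → SolvesNZCB Γ A →
    Σ ℕ λ k → Σ ℕ λ N → (n : ℕ) → N ≤ n →
      Σ (Fin n → AbelianGroup.Carrier Γ) λ ψ → Σ (Matroid n) λ M₁ → Σ (Matroid n) λ M₂ →
        2 ^ (n / suc k) ≤ queries (A n ψ) M₁ M₂
mainTheorem15 Γ (g , g≉ε , g∙g≈ε) A solves = 3 , 2 , λ
  { (suc zero) (s≤s ())
  ; (suc (suc n)) _ → label (suc (suc n)) , M₁ n , M₀ n ,
                      ≤-trans (^-monoʳ-≤ 2 ([2+n]/4≤pairs n)) (queryLowerBound n A solves) }
  where open HardInstance Γ g g≉ε g∙g≈ε
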